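{- A down-up permutation $\sigma\in\mathrm{Alt}_n$ satisfies $\hat\imath(\sigma)=\lfloor n^2/4\rfloor$ if and only if $\sigma$ is $312$-avoiding.
   Context: $\mathrm{Alt}_n$ is the set of permutations $\sigma\in\mathfrak S_n$ with $\sigma_1>\sigma_2<\sigma_3>\cdots$. $\hat\imath(\sigma)=\sum_{i=1}^{n-1}\hat c_i(\sigma)$, where $\hat c_i(\sigma)$ is the number of $j>i$ with $\sigma_i>\sigma_j$ if $i$ is odd, and the number of $j>i$ with $\sigma_i<\sigma_j$ if $i$ is even. $\sigma$ is $312$-avoiding if there are no indices $i<k<j$ with $\sigma_k<\sigma_j<\sigma_i$. -}

module Defs where

import Data.Bool
open import Data.Bool using (Bool; true; false; if_then_else_)
open import Data.Nat using (ℕ; zero; suc; _+_; _*_; _/_)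
open import Data.Fin using (Fin; toℕ) renaming (_<_ to _<ᶠ_; _<?_ to _<ᶠ?_)
open import Data.Fin.Permutation using (Permutation′; _⟨$⟩ʳ_)
open import Data.Nat.ListAction using (sum)
open import Data.List using (List; map; filter; length; allFin)
import Data.Product
open import Data.Product using (_×_)
open import Relation.Nullary using (¬_; Dec; does)
open import Relation.Binary.PropositionalEquality using (_≡_)

-- Positions are Fin n = {0,…,n-1}; 0-based index k is the paper's position k+1,
-- so paper position k+1 is odd iff toℕ k is even.  Values likewise shifted by 1
-- (order-preserving, so irrelevant for comparisons).

isEven : ℕ → Bool
isEven zero = true
isEven (suc n) = if isEven n then false else true

Perm : ℕ → Set
Perm n = Permutation′ n

-- Down-up (alternating) permutations, Alt_n: σ₁ > σ₂ < σ₃ > ⋯.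
IsDownUp : {n : ℕ} → Perm n → Set
IsDownUp {n} σ =
  (k l : Fin n) → toℕ l ≡ suc (toℕ k) →
    (isEven (toℕ k) ≡ true → (σ ⟨$⟩ʳ l) <ᶠ (σ ⟨$⟩ʳ k)) ×
    (isEven (toℕ k) ≡ false → (σ ⟨$⟩ʳ k) <ᶠ (σ ⟨$⟩ʳ l))

contributes : {n : ℕ} → Perm n → Fin n → Fin n → Bool
contributes σ i j =
  if does (i <ᶠ? j)
  then (if isEven (toℕ i)
        then does ((σ ⟨$⟩ʳ j) <ᶠ? (σ ⟨$⟩ʳ i))
        else does ((σ ⟨$⟩ʳ i) <ᶠ? (σ ⟨$⟩ʳ j)))
  else false

cHat : {n : ℕ} → Perm n → Fin n → ℕ
cHat {n} σ i = length (filter (λ j → Data.Bool._≟_ (contributes σ i j) true) (allFin n))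

-- î(σ) = Σ_i ĉ_i(σ).  (The term for the last position n is 0 since there
-- is no j > n, so summing over all positions equals Σ_{i=1}^{n-1}.)
iHat : {n : ℕ} → Perm n → ℕ
iHat {n} σ = sum (map (cHat σ) (allFin n))

Contains312 : {n : ℕ} → Perm n → Set
Contains312 {n} σ =
  Data.Product.Σ (Fin n) λ i → Data.Product.Σ (Fin n) λ k → Data.Product.Σ (Fin n) λ j →
    i <ᶠ k × k <ᶠ j × (σ ⟨$⟩ʳ k) <ᶠ (σ ⟨$⟩ʳ j) × (σ ⟨$⟩ʳ j) <ᶠ (σ ⟨$⟩ʳ i)

Avoids312 : {n : ℕ} → Perm n → Set
Avoids312 σ = ¬ Contains312 σ

module Submission where

-- Positions are 0-based, so the paper's pairs of positions (2j+1, 2j+2) are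
-- (a, a+1) with a = 2j, and σ descends inside each such pair.  For b > a+1 at
-- least one of "σ_b < σ_a" (counted by ĉ_a) and "σ_b > σ_{a+1}" (counted by
-- ĉ_{a+1}) holds, and both hold iff (a, a+1, b) is an occurrence of 312.  Hence
--   ĉ_a + ĉ_{a+1} = (n - a - 1) + d_a,
-- where the defect d_a counts these occurrences.  Summing over the pairs (an
-- odd last position contributes nothing) gives
--   î(σ) = Σ_{j<⌊n/2⌋} (n - 2j - 1) + Σ_j d_{2j} = ⌊n²/4⌋ + Σ_j d_{2j}.
-- If σ avoids 312 all defects vanish.  Conversely, from an occurrence
-- σ_k < σ_j < σ_i (i < k < j) a discrete intermediate value argument yields a
-- descent σ_{t+1} < σ_j < σ_t with i ≤ t < k; descents of a down-up
-- permutation start at even positions, so d_t ≥ 1.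

open import Defs
open import Algebra.Properties.CommutativeSemigroup using (interchange)
open import Data.Bool using (Bool; true; false; if_then_else_; _∧_)
import Data.Bool
open import Data.Empty using (⊥-elim)
open import Data.Fin using (Fin; toℕ; fromℕ<)
open import Data.Fin.Permutation using (_⟨$⟩ʳ_)
open import Data.Fin.Properties using (toℕ<n; toℕ-fromℕ<; toℕ-injective)
open import Data.List using (List; []; _∷_; map; filter; length; allFin; tabulate)
open import Data.List.Properties using (map-tabulate)
open import Data.Nat using (ℕ; zero; suc; _+_; _*_; _/_; _∸_; _≤_; _<_; z≤n; s≤s; z<s; s<s)
open import Data.Nat.DivMod using (m*n/n≡m; +-distrib-/-∣ʳ)
open import Data.Nat.Divisibility using (divides-refl)
open import Data.Nat.ListAction using (sum)
open import Data.Nat.Properties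
open import Data.Nat.Tactic.RingSolver using (solve-∀)
open import Data.Product using (_×_; _,_; proj₁; proj₂; Σ)
open import Data.Sum using (_⊎_; inj₁; inj₂; [_,_]′)
import Data.Sum
open import Function using (_∘_; id)
open import Function.Bundles using (Injection)
open import Function.Properties.Inverse using (↔⇒↣)
open import Relation.Binary using (tri<; tri≈; tri>)
open import Relation.Binary.PropositionalEquality
open import Relation.Nullary using (¬_; does; yes; no)
open import Relation.Nullary.Decidable using (dec-true; dec-false)

indicator : Bool → ℕ
indicator true  = 1
indicator false = 0

sumTo : ℕ → (ℕ → ℕ) → ℕ
sumTo zero    f = 0
sumTo (suc n) f = f 0 + sumTo n (f ∘ suc)

sumTo-snoc : ∀ n f → sumTo (suc n) f ≡ sumTo n f + f n
sumTo-snoc zero    f = +-comm (f 0) 0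
sumTo-snoc (suc n) f =
  trans (cong (f 0 +_) (sumTo-snoc n (f ∘ suc))) (sym (+-assoc (f 0) _ _))

sumTo-cong : ∀ n {f h} → (∀ b → b < n → f b ≡ h b) → sumTo n f ≡ sumTo n h
sumTo-cong zero    eq = refl
sumTo-cong (suc n) eq = cong₂ _+_ (eq 0 z<s) (sumTo-cong n (λ b b<n → eq (suc b) (s<s b<n)))

sumTo-zero : ∀ n {f} → (∀ b → b < n → f b ≡ 0) → sumTo n f ≡ 0
sumTo-zero n vanish = trans (sumTo-cong n vanish) (sumTo-zeros n)
  where
  sumTo-zeros : ∀ n → sumTo n (λ _ → 0) ≡ 0
  sumTo-zeros zero    = refl
  sumTo-zeros (suc n) = sumTo-zeros n

sumTo-+ : ∀ n f h → sumTo n (λ b → f b + h b) ≡ sumTo n f + sumTo n h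
sumTo-+ zero    f h = refl
sumTo-+ (suc n) f h =
  trans (cong (f 0 + h 0 +_) (sumTo-+ n (f ∘ suc) (h ∘ suc)))
        (interchange +-commutativeSemigroup (f 0) (h 0) _ _)

term≤sumTo : ∀ n f {t} → t < n → f t ≤ sumTo n f
term≤sumTo (suc n) f {zero}  _         = m≤m+n (f 0) _
term≤sumTo (suc n) f {suc t} (s<s t<n) = ≤-trans (term≤sumTo n (f ∘ suc) t<n) (m≤n+m _ (f 0))

sumTo-ones : ∀ n → sumTo n (λ _ → 1) ≡ n
sumTo-ones zero    = refl
sumTo-ones (suc n) = cong suc (sumTo-ones n)

count-above : ∀ n a → sumTo n (λ b → indicator (does (a <? b))) ≡ n ∸ suc a
count-above zero    a       = refl
count-above (suc n) zero    = sumTo-ones n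
count-above (suc n) (suc a) = count-above n a

double : ℕ → ℕ
double zero    = zero
double (suc m) = suc (suc (double m))

half : ℕ → ℕ
half zero          = zero
half (suc zero)    = zero
half (suc (suc n)) = suc (half n)

double≡+ : ∀ m → double m ≡ m + m
double≡+ zero    = refl
double≡+ (suc m) = cong suc (trans (cong suc (double≡+ m)) (sym (+-suc m m)))

parity : ∀ n → n ≡ double (half n) ⊎ n ≡ suc (double (half n))
parity zero          = inj₁ refl
parity (suc zero)    = inj₂ refl
parity (suc (suc n)) = Data.Sum.map (cong (suc ∘ suc)) (cong (suc ∘ suc)) (parity n)

double-half≤ : ∀ n → double (half n) ≤ n
double-half≤ n = [ ≤-reflexive ∘ sym , (λ e → ≤-trans (n≤1+n _) (≤-reflexive (sym e))) ]′ (parity n)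

≤suc-double-half : ∀ n → n ≤ suc (double (half n))
≤suc-double-half n = [ (λ e → ≤-trans (≤-reflexive e) (n≤1+n _)) , ≤-reflexive ]′ (parity n)

double-mono-≤ : ∀ {j m} → j ≤ m → double j ≤ double m
double-mono-≤ z≤n       = z≤n
double-mono-≤ (s≤s j≤m) = s≤s (s≤s (double-mono-≤ j≤m))

double-cancel-≤ : ∀ {j m} → double j ≤ double m → j ≤ m
double-cancel-≤ {zero}          _               = z≤n
double-cancel-≤ {suc j} {suc m} (s≤s (s≤s le)) = s≤s (double-cancel-≤ le)

isEven-double : ∀ m → isEven (double m) ≡ true
isEven-double zero    = refl
isEven-double (suc m) rewrite isEven-double m = refl

isEven-suc : ∀ {a} → isEven a ≡ true → isEven (suc a) ≡ false
isEven-suc even rewrite even = refl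

sumTo-pairs : ∀ m f → sumTo (double m) f ≡ sumTo m (λ j → f (double j) + f (suc (double j)))
sumTo-pairs zero    f = refl
sumTo-pairs (suc m) f =
  trans (cong (λ s → f 0 + (f 1 + s)) (sumTo-pairs m (f ∘ suc ∘ suc)))
        (sym (+-assoc (f 0) (f 1) _))

quarter-even : ∀ m → double m * double m / 4 ≡ m * m
quarter-even m rewrite double≡+ m = trans (cong (_/ 4) (square m)) (m*n/n≡m (m * m) 4)
  where
  square : ∀ m → (m + m) * (m + m) ≡ m * m * 4
  square = solve-∀

quarter-odd : ∀ m → suc (double m) * suc (double m) / 4 ≡ m * m + m
quarter-odd m rewrite double≡+ m =
  trans (cong (_/ 4) (square m))
        (trans (+-distrib-/-∣ʳ 1 {d = 4} (divides-refl (m * m + m))) (m*n/n≡m (m * m + m) 4))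
  where
  square : ∀ m → suc (m + m) * suc (m + m) ≡ 1 + (m * m + m) * 4
  square = solve-∀

staircase : ∀ m n → double m ≤ n → sumTo m (λ j → n ∸ suc (double j)) + m * m ≡ m * n
staircase zero    n             _              = refl
staircase (suc m) (suc (suc n)) (s≤s (s≤s le)) = begin
    suc n + S + suc m * suc m         ≡⟨ regroup n S m ⟩
    (S + m * m) + (2 + n + (m + m))   ≡⟨ cong (_+ (2 + n + (m + m))) (staircase m n le) ⟩
    m * n + (2 + n + (m + m))         ≡⟨ expand m n ⟩
    suc m * suc (suc n)               ∎
  where
  open ≡-Reasoning
  S = sumTo m (λ j → n ∸ suc (double j))
  regroup : ∀ n S m → suc n + S + suc m * suc m ≡ (S + m * m) + (2 + n + (m + m))
  regroup = solve-∀
  expand : ∀ m n → m * n + (2 + n + (m + m)) ≡ suc m * suc (suc n)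
  expand = solve-∀

staircase-quarter : ∀ m n → n ≡ double m ⊎ n ≡ suc (double m) →
  sumTo m (λ j → n ∸ suc (double j)) ≡ n * n / 4
staircase-quarter m .(double m) (inj₁ refl) =
  +-cancelʳ-≡ (m * m) _ _ (begin
    _ + m * m                       ≡⟨ staircase m (double m) ≤-refl ⟩
    m * double m                    ≡⟨ cong (m *_) (double≡+ m) ⟩
    m * (m + m)                     ≡⟨ *-distribˡ-+ m m m ⟩
    m * m + m * m                   ≡⟨ cong (_+ m * m) (sym (quarter-even m)) ⟩
    double m * double m / 4 + m * m ∎)
  where open ≡-Reasoning
staircase-quarter m .(suc (double m)) (inj₂ refl) =
  +-cancelʳ-≡ (m * m) _ _ (begin
    _ + m * m                                   ≡⟨ staircase m (suc (double m)) (n≤1+n _) ⟩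
    m * suc (double m)                          ≡⟨ cong (λ k → m * suc k) (double≡+ m) ⟩
    m * suc (m + m)                             ≡⟨ expand m ⟩
    (m * m + m) + m * m                         ≡⟨ cong (_+ m * m) (sym (quarter-odd m)) ⟩
    suc (double m) * suc (double m) / 4 + m * m ∎)
  where
  open ≡-Reasoning
  expand : ∀ m → m * suc (m + m) ≡ (m * m + m) + m * m
  expand = solve-∀

crossing : (g : ℕ → ℕ) (v a d : ℕ) → v < g a → g (d + a) < v →
  (∀ x → a ≤ x → x ≤ d + a → g x ≢ v) →
  Σ ℕ λ t → a ≤ t × t < d + a × g (suc t) < v × v < g t
crossing g v a zero    v<ga gda<v _ = ⊥-elim (<-asym v<ga gda<v)
crossing g v a (suc d) v<ga gda<v avoids with <-cmp v (g (d + a))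
... | tri< v<g _ _ = d + a , m≤n+m a d , n<1+n _ , gda<v , v<g
... | tri≈ _ v≡g _ = ⊥-elim (avoids (d + a) (m≤n+m a d) (n≤1+n _) (sym v≡g))
... | tri> _ _ g<v with crossing g v a d v<ga g<v (λ x a≤x x≤ → avoids x a≤x (m≤n⇒m≤1+n x≤))
...   | t , a≤t , t<da , below , above = t , a≤t , m<n⇒m<1+n t<da , below , above

inversionTest : (a b x y : ℕ) → Bool
inversionTest a b x y =
  if does (a <? b) then (if isEven a then does (y <? x) else does (x <? y)) else false

-- The argument for the values g 0, …, g (n-1) of an arbitrary function.
module OnPrefix (n : ℕ) (g : ℕ → ℕ) where

  counts : ℕ → ℕ → Bool
  counts a b = inversionTest a b (g a) (g b)

  ĉ : ℕ → ℕ
  ĉ a = sumTo n (λ b → indicator (counts a b))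

  completes312 : ℕ → ℕ → Bool
  completes312 a b = does (suc a <? b) ∧ (does (g b <? g a) ∧ does (g (suc a) <? g b))

  defect : ℕ → ℕ
  defect a = sumTo n (λ b → indicator (completes312 a b))

  excess : ℕ → ℕ
  excess m = sumTo m (λ j → defect (double j))

  DownUp : Set
  DownUp = ∀ k → suc k < n →
    (isEven k ≡ true → g (suc k) < g k) × (isEven k ≡ false → g k < g (suc k))

  InjectiveOn : Set
  InjectiveOn = ∀ {x y} → x < n → y < n → g x ≡ g y → x ≡ y

  Has312 : Set
  Has312 = Σ ℕ λ i → Σ ℕ λ k → Σ ℕ λ j →
    i < k × k < j × j < n × g k < g j × g j < g i

  pair-pointwise : ∀ a b → isEven a ≡ true → g (suc a) < g a →
    indicator (counts a b) + indicator (counts (suc a) b)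
      ≡ indicator (does (a <? b)) + indicator (completes312 a b)
  pair-pointwise a b even desc with <-cmp b (suc a)
  ... | tri< b<1+a _ _
    rewrite dec-false (a <? b) (<⇒≱ b<1+a) | dec-false (suc a <? b) (<⇒≯ b<1+a) = refl
  ... | tri≈ _ refl _
    rewrite dec-true (a <? suc a) (n<1+n a) | dec-false (suc a <? suc a) (<-irrefl refl)
          | even | dec-true (g (suc a) <? g a) desc = refl
  ... | tri> _ _ 1+a<b with g b <? g a
  ...   | yes below
    rewrite dec-true (a <? b) (<-trans (n<1+n a) 1+a<b) | dec-true (suc a <? b) 1+a<b
          | even | dec-true (g b <? g a) below = refl
  ...   | no not-below
    rewrite dec-true (a <? b) (<-trans (n<1+n a) 1+a<b) | dec-true (suc a <? b) 1+a<b
          | even | dec-false (g b <? g a) not-below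
          | dec-true (g (suc a) <? g b) (<-≤-trans desc (≮⇒≥ not-below)) = refl

  pair-sum : ∀ a → isEven a ≡ true → g (suc a) < g a →
    ĉ a + ĉ (suc a) ≡ (n ∸ suc a) + defect a
  pair-sum a even desc = begin
      ĉ a + ĉ (suc a)
    ≡⟨ sym (sumTo-+ n _ _) ⟩
      sumTo n (λ b → indicator (counts a b) + indicator (counts (suc a) b))
    ≡⟨ sumTo-cong n (λ b _ → pair-pointwise a b even desc) ⟩
      sumTo n (λ b → indicator (does (a <? b)) + indicator (completes312 a b))
    ≡⟨ sumTo-+ n _ _ ⟩
      sumTo n (λ b → indicator (does (a <? b))) + defect a
    ≡⟨ cong (_+ defect a) (count-above n a) ⟩
      (n ∸ suc a) + defect a
    ∎
    where open ≡-Reasoning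

  ĉ-last : ∀ a → n ≤ suc a → ĉ a ≡ 0
  ĉ-last a n≤1+a = sumTo-zero n nothing-after
    where
    nothing-after : ∀ b → b < n → indicator (counts a b) ≡ 0
    nothing-after b b<n
      rewrite dec-false (a <? b) (λ a<b → <-irrefl refl (<-≤-trans b<n (≤-trans n≤1+a a<b))) = refl

  sum-ĉ-even-part : ∀ m → n ≡ double m ⊎ n ≡ suc (double m) → sumTo n ĉ ≡ sumTo (double m) ĉ
  sum-ĉ-even-part m (inj₁ n≡2m)   = cong (λ k → sumTo k ĉ) n≡2m
  sum-ĉ-even-part m (inj₂ n≡2m+1) = begin
      sumTo n ĉ
    ≡⟨ cong (λ k → sumTo k ĉ) n≡2m+1 ⟩
      sumTo (suc (double m)) ĉ
    ≡⟨ sumTo-snoc (double m) ĉ ⟩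
      sumTo (double m) ĉ + ĉ (double m)
    ≡⟨ cong (sumTo (double m) ĉ +_) (ĉ-last (double m) (≤-reflexive n≡2m+1)) ⟩
      sumTo (double m) ĉ + 0
    ≡⟨ +-identityʳ _ ⟩
      sumTo (double m) ĉ
    ∎
    where open ≡-Reasoning

  paired-sum : DownUp → ∀ m → double m ≤ n →
    sumTo (double m) ĉ ≡ sumTo m (λ j → n ∸ suc (double j)) + excess m
  paired-sum du m 2m≤n = begin
      sumTo (double m) ĉ
    ≡⟨ sumTo-pairs m ĉ ⟩
      sumTo m (λ j → ĉ (double j) + ĉ (suc (double j)))
    ≡⟨ sumTo-cong m pair ⟩
      sumTo m (λ j → (n ∸ suc (double j)) + defect (double j))
    ≡⟨ sumTo-+ m _ _ ⟩
      sumTo m (λ j → n ∸ suc (double j)) + excess m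
    ∎
    where
    open ≡-Reasoning
    pair : ∀ j → j < m → ĉ (double j) + ĉ (suc (double j)) ≡ (n ∸ suc (double j)) + defect (double j)
    pair j j<m = pair-sum (double j) (isEven-double j)
      (proj₁ (du (double j) (≤-trans (double-mono-≤ j<m) 2m≤n)) (isEven-double j))

  sum-ĉ : DownUp → sumTo n ĉ ≡ n * n / 4 + excess (half n)
  sum-ĉ du = begin
      sumTo n ĉ
    ≡⟨ sum-ĉ-even-part m (parity n) ⟩
      sumTo (double m) ĉ
    ≡⟨ paired-sum du m (double-half≤ n) ⟩
      sumTo m (λ j → n ∸ suc (double j)) + excess m
    ≡⟨ cong (_+ excess m) (staircase-quarter m n (parity n)) ⟩
      n * n / 4 + excess m
    ∎
    where
    open ≡-Reasoning
    m = half n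

  avoids⇒defect≡0 : ¬ Has312 → ∀ a → defect a ≡ 0
  avoids⇒defect≡0 avoids a = sumTo-zero n no-occurrence
    where
    no-occurrence : ∀ b → b < n → indicator (completes312 a b) ≡ 0
    no-occurrence b b<n with suc a <? b | g b <? g a | g (suc a) <? g b
    ... | yes 1+a<b | yes below | yes above =
      ⊥-elim (avoids (a , suc a , b , n<1+n a , 1+a<b , b<n , above , below))
    ... | no not-after | _ | _
      rewrite dec-false (suc a <? b) not-after = refl
    ... | yes after | no not-below | _
      rewrite dec-true (suc a <? b) after | dec-false (g b <? g a) not-below = refl
    ... | yes after | yes below | no not-above
      rewrite dec-true (suc a <? b) after | dec-true (g b <? g a) below
            | dec-false (g (suc a) <? g b) not-above = refl

  adjacent312 : InjectiveOn → Has312 →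
    Σ ℕ λ t → Σ ℕ λ b → suc t < b × b < n × g (suc t) < g b × g b < g t
  adjacent312 inj (i , k , j , i<k , k<j , j<n , gk<gj , gj<gi)
    with crossing g (g j) i (k ∸ i) gj<gi (subst (λ x → g x < g j) (sym k∸i+i) gk<gj) avoids
    where
    k∸i+i : (k ∸ i) + i ≡ k
    k∸i+i = m∸n+n≡m (<⇒≤ i<k)
    avoids : ∀ x → i ≤ x → x ≤ (k ∸ i) + i → g x ≢ g j
    avoids x _ x≤ gx≡gj = <-irrefl (inj (<-trans x<j j<n) j<n gx≡gj) x<j
      where x<j = ≤-<-trans (subst (x ≤_) k∸i+i x≤) k<j
  ... | t , _ , t<k , below , above =
    t , j , ≤-<-trans (subst (t <_) (m∸n+n≡m (<⇒≤ i<k)) t<k) k<j , j<n , below , above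

  descent-even : DownUp → ∀ t → suc t < n → g (suc t) < g t → t ≡ double (half t)
  descent-even du t 1+t<n desc with parity t
  ... | inj₁ t-even = t-even
  ... | inj₂ t-odd  = ⊥-elim (<-asym desc
          (proj₂ (du t 1+t<n) (trans (cong isEven t-odd) (isEven-suc {double (half t)} (isEven-double (half t))))))

  -- A 312 occurrence forces a positive total defect: its adjacent form
  -- (t, t+1, b) has t even, i.e. t = 2h with h < ⌊n/2⌋.
  occurrence⇒excess : DownUp → InjectiveOn → Has312 → 1 ≤ excess (half n)
  occurrence⇒excess du inj occ with adjacent312 inj occ
  ... | t , b , 1+t<b , b<n , below , above = begin
      1                            ≡⟨ sym (cong indicator completes) ⟩
      indicator (completes312 t b) ≤⟨ term≤sumTo n _ b<n ⟩
      defect t                     ≡⟨ cong defect t≡2h ⟩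
      defect (double h)            ≤⟨ term≤sumTo (half n) (λ j → defect (double j)) h<half ⟩
      excess (half n)              ∎
    where
    open ≤-Reasoning
    completes : completes312 t b ≡ true
    completes rewrite dec-true (suc t <? b) 1+t<b | dec-true (g b <? g t) above
                    | dec-true (g (suc t) <? g b) below = refl
    h = half t
    t≡2h = descent-even du t (<-trans 1+t<b b<n) (<-trans below above)
    h<half : h < half n
    h<half = double-cancel-≤ (subst (λ x → suc (suc x) ≤ double (half n)) t≡2h
               (≤-trans 1+t<b (≤-pred (≤-trans b<n (≤suc-double-half n)))))

  characterisation : DownUp → InjectiveOn →
    (sumTo n ĉ ≡ n * n / 4 → ¬ Has312) × (¬ Has312 → sumTo n ĉ ≡ n * n / 4)
  characterisation du inj = extremal⇒avoids , avoids⇒extremal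
    where
    extremal⇒avoids : sumTo n ĉ ≡ n * n / 4 → ¬ Has312
    extremal⇒avoids eq occ = <-irrefl refl (≤-trans (occurrence⇒excess du inj occ) (≤-reflexive no-excess))
      where
      no-excess : excess (half n) ≡ 0
      no-excess = +-cancelˡ-≡ (n * n / 4) _ _ (trans (sym (sum-ĉ du)) (trans eq (sym (+-identityʳ _))))
    avoids⇒extremal : ¬ Has312 → sumTo n ĉ ≡ n * n / 4
    avoids⇒extremal avoids = begin
        sumTo n ĉ
      ≡⟨ sum-ĉ du ⟩
        n * n / 4 + excess (half n)
      ≡⟨ cong (n * n / 4 +_) (sumTo-zero (half n) (λ j _ → avoids⇒defect≡0 avoids (double j))) ⟩
        n * n / 4 + 0
      ≡⟨ +-identityʳ _ ⟩
        n * n / 4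
      ∎
      where open ≡-Reasoning

open OnPrefix using (ĉ; DownUp; InjectiveOn; Has312; characterisation)

extend : ∀ {n} → (Fin n → ℕ) → ℕ → ℕ
extend {zero}  f _       = 0
extend {suc n} f zero    = f Fin.zero
extend {suc n} f (suc k) = extend (f ∘ Fin.suc) k

extend-toℕ : ∀ {n} (f : Fin n → ℕ) i → extend f (toℕ i) ≡ f i
extend-toℕ f Fin.zero    = refl
extend-toℕ f (Fin.suc i) = extend-toℕ (f ∘ Fin.suc) i

length-filter-true : ∀ {A : Set} (p : A → Bool) (xs : List A) →
  length (filter (λ x → Data.Bool._≟_ (p x) true) xs) ≡ sum (map (indicator ∘ p) xs)
length-filter-true p []       = refl
length-filter-true p (x ∷ xs) with p x
... | true  = cong suc (length-filter-true p xs)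
... | false = length-filter-true p xs

sum-tabulate : ∀ {n} (f : Fin n → ℕ) (h : ℕ → ℕ) → (∀ i → f i ≡ h (toℕ i)) →
  sum (tabulate f) ≡ sumTo n h
sum-tabulate {zero}  f h eq = refl
sum-tabulate {suc n} f h eq =
  cong₂ _+_ (eq Fin.zero) (sum-tabulate (f ∘ Fin.suc) (h ∘ suc) (eq ∘ Fin.suc))

sum-allFin : ∀ {n} (f : Fin n → ℕ) (h : ℕ → ℕ) → (∀ i → f i ≡ h (toℕ i)) →
  sum (map f (allFin n)) ≡ sumTo n h
sum-allFin f h eq = trans (cong sum (map-tabulate id f)) (sum-tabulate f h eq)

module _ {n : ℕ} (σ : Perm n) where

  values : ℕ → ℕ
  values = extend (λ i → toℕ (σ ⟨$⟩ʳ i))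

  values-toℕ : ∀ i → values (toℕ i) ≡ toℕ (σ ⟨$⟩ʳ i)
  values-toℕ = extend-toℕ _

  values-fromℕ< : ∀ {k} (k<n : k < n) → values k ≡ toℕ (σ ⟨$⟩ʳ fromℕ< k<n)
  values-fromℕ< k<n = trans (cong values (sym (toℕ-fromℕ< k<n))) (values-toℕ _)

  iHat≡sum-ĉ : iHat σ ≡ sumTo n (ĉ n values)
  iHat≡sum-ĉ = sum-allFin (cHat σ) (ĉ n values) cHat≡ĉ
    where
    cHat≡ĉ : ∀ i → cHat σ i ≡ ĉ n values (toℕ i)
    cHat≡ĉ i = trans (length-filter-true (contributes σ i) (allFin n))
      (sum-allFin _ _ (λ j → cong indicator
        (cong₂ (inversionTest (toℕ i) (toℕ j)) (sym (values-toℕ i)) (sym (values-toℕ j)))))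

  downUp-values : IsDownUp σ → DownUp n values
  downUp-values du k 1+k<n =
      (λ even → subst₂ _<_ (sym (values-fromℕ< 1+k<n)) (sym (values-fromℕ< k<n))
                  (proj₁ adjacent (trans (cong isEven (toℕ-fromℕ< k<n)) even)))
    , (λ odd  → subst₂ _<_ (sym (values-fromℕ< k<n)) (sym (values-fromℕ< 1+k<n))
                  (proj₂ adjacent (trans (cong isEven (toℕ-fromℕ< k<n)) odd)))
    where
    k<n = <-trans (n<1+n k) 1+k<n
    adjacent = du (fromℕ< k<n) (fromℕ< 1+k<n)
                  (trans (toℕ-fromℕ< 1+k<n) (cong suc (sym (toℕ-fromℕ< k<n))))

  values-injective : InjectiveOn n values
  values-injective {x} {y} x<n y<n eq = begin
      x                    ≡⟨ sym (toℕ-fromℕ< x<n) ⟩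
      toℕ (fromℕ< x<n)     ≡⟨ cong toℕ (Injection.injective (↔⇒↣ σ) (toℕ-injective σx≡σy)) ⟩
      toℕ (fromℕ< y<n)     ≡⟨ toℕ-fromℕ< y<n ⟩
      y                    ∎
    where
    open ≡-Reasoning
    σx≡σy = trans (sym (values-fromℕ< x<n)) (trans eq (values-fromℕ< y<n))

  has312⇒contains312 : Has312 n values → Contains312 σ
  has312⇒contains312 (i , k , j , i<k , k<j , j<n , gk<gj , gj<gi) =
    fromℕ< i<n , fromℕ< k<n , fromℕ< j<n ,
    subst₂ _<_ (sym (toℕ-fromℕ< i<n)) (sym (toℕ-fromℕ< k<n)) i<k ,
    subst₂ _<_ (sym (toℕ-fromℕ< k<n)) (sym (toℕ-fromℕ< j<n)) k<j ,
    subst₂ _<_ (values-fromℕ< k<n) (values-fromℕ< j<n) gk<gj ,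
    subst₂ _<_ (values-fromℕ< j<n) (values-fromℕ< i<n) gj<gi
    where
    k<n = <-trans k<j j<n
    i<n = <-trans i<k k<n

  contains312⇒has312 : Contains312 σ → Has312 n values
  contains312⇒has312 (i , k , j , i<k , k<j , σk<σj , σj<σi) =
    toℕ i , toℕ k , toℕ j , i<k , k<j , toℕ<n j ,
    subst₂ _<_ (sym (values-toℕ k)) (sym (values-toℕ j)) σk<σj ,
    subst₂ _<_ (sym (values-toℕ j)) (sym (values-toℕ i)) σj<σi

proposition9p3 : (n : ℕ) (σ : Perm n) → IsDownUp σ →
    (iHat σ ≡ (n * n) / 4 → Avoids312 σ) × (Avoids312 σ → iHat σ ≡ (n * n) / 4)
proposition9p3 n σ du =
    (λ extremal occ → extremal⇒avoids (trans (sym (iHat≡sum-ĉ σ)) extremal) (contains312⇒has312 σ occ))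
  , (λ avoids → trans (iHat≡sum-ĉ σ) (avoids⇒extremal (avoids ∘ has312⇒contains312 σ)))
  where
  core = characterisation n (values σ) (downUp-values σ du) (values-injective σ)
  extremal⇒avoids = proj₁ core
  avoids⇒extremal = proj₂ core
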